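{- Let $\mathcal P$ be the Petersen graph whose vertices are the $2$-subsets of $\{1,2,3,4,5\}$, two vertices adjacent iff disjoint. Let $V=\mathbb{Q}^{10}$ with basis $\{\ell_{ij}\}$ indexed by the vertices, and $A$ the adjacency operator $A\ell_b=\sum_{a\sim b}\ell_a$. Define the linear map $\sigma:V\to V$ by $\sigma(\ell_{12})=-\ell_{34},\ \sigma(\ell_{34})=-\ell_{12},\ \sigma(\ell_{23})=-\ell_{14},\ \sigma(\ell_{14})=-\ell_{23},\ \sigma(\ell_{24})=-\ell_{13},\ \sigma(\ell_{13})=-\ell_{24}$, and $\sigma(\ell_{b})=\ell_b$ for $b\in\{15,25,35,45\}$. Then $\sigma$ maps each of the subspaces $\mathrm{Im}(1-A)$ and $\ker(1-A)$ (each $5$-dimensional) into itself, so it preserves the decomposition $V=\mathrm{Im}(1-A)\oplus\ker(1-A)$. Moreover $\sigma$ commutes with the action of every permutation $\pi$ of $\{1,2,3,4\}$ on $V$ given by $\ell_{ij}\mapsto\ell_{\pi(i)\pi(j)}$ (with $\pi(5)=5$).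
   Context: In the paper this $\sigma$ (called $\sigma_{56}$) is the lift to the Petersen vertex representation of an extra transposition extending the $S_5=\mathrm{Aut}(\mathcal P)$ symmetry to $S_6$. The eigenvalue-$1$ eigenspace $\ker(1-A)$ is the $S_5$-representation $V_{32}$, and $\mathrm{Im}(1-A)$ is the sum of the eigenvalue $3$ and $-2$ eigenspaces. -}

module Defs where

open import Data.Nat using (ℕ; zero; suc; z≤n; s≤s)
open import Data.Fin using (Fin; zero; suc; _<_; _<?_; toℕ; #_)
open import Data.Fin.Properties using (<-cmp; <-irrefl)
open import Data.Fin.Permutation using (Permutation′; _⟨$⟩ʳ_; _⟨$⟩ˡ_; inverseˡ)
open import Data.Fin.Properties using () renaming (_≟_ to _≟F_)
open import Data.List using (List; []; _∷_; foldr; map)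
open import Data.Rational using (ℚ; 0ℚ; 1ℚ; _+_; _*_; -_; _-_)
open import Data.Bool using (Bool; true; false; if_then_else_; _∧_; not)
open import Data.Product using (Σ; ∃; _×_; _,_)
open import Data.Empty using (⊥-elim)
open import Relation.Nullary using (does; ¬_)
open import Relation.Nullary.Decidable using (True; toWitness)
open import Relation.Binary using (tri<; tri≈; tri>)
open import Relation.Binary.PropositionalEquality using (_≡_; refl; cong; trans; sym)

-- Vertices of the Petersen graph: 2-subsets {i,j} of {1,..,5},
-- encoded as i < j in Fin 5 (Fin index k stands for the number k+1).

record Vertex : Set where
  constructor mkV
  field
    fst : Fin 5
    snd : Fin 5
    lt  : fst < snd
open Vertex public

v : (i j : Fin 5) → {True (i <? j)} → Vertex
v i j {p} = mkV i j (toWitness p)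

_==_ : Vertex → Vertex → Bool
a == b = does (fst a ≟F fst b) ∧ does (snd a ≟F snd b)

allV : List Vertex
allV = v (# 0) (# 1) ∷ v (# 0) (# 2) ∷ v (# 0) (# 3) ∷ v (# 0) (# 4)
     ∷ v (# 1) (# 2) ∷ v (# 1) (# 3) ∷ v (# 1) (# 4)
     ∷ v (# 2) (# 3) ∷ v (# 2) (# 4)
     ∷ v (# 3) (# 4) ∷ []

adj : Vertex → Vertex → Bool
adj a b = not (does (fst a ≟F fst b)) ∧ not (does (fst a ≟F snd b))
        ∧ not (does (snd a ≟F fst b)) ∧ not (does (snd a ≟F snd b))

V : Set
V = Vertex → ℚ

_≈_ : V → V → Set
u ≈ w = ∀ a → u a ≡ w a

zeroV : V
zeroV _ = 0ℚ

_+V_ : V → V → V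
(u +V w) a = u a + w a

_-V_ : V → V → V
(u -V w) a = u a - w a

_•_ : ℚ → V → V
(c • u) a = c * u a

sumL : {A : Set} → List A → (A → V) → V
sumL xs f = foldr (λ x acc → f x +V acc) zeroV xs

ℓ : Vertex → V
ℓ b a = if a == b then 1ℚ else 0ℚ

linExt : (Vertex → V) → V → V
linExt img u = sumL allV (λ b → u b • img b)

Aℓ : Vertex → V
Aℓ b = sumL allV (λ a → if adj a b then ℓ a else zeroV)

A : V → V
A = linExt Aℓ

oneMinusA : V → V
oneMinusA u = u -V A u

-- the map σ on basis vectors (indices shifted by one: Fin k ↔ k+1)
σℓ : Vertex → V
σℓ (mkV zero (suc zero) _) = (- 1ℚ) • ℓ (v (# 2) (# 3))
σℓ (mkV (suc (suc zero)) (suc (suc (suc zero))) _) = (- 1ℚ) • ℓ (v (# 0) (# 1))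
σℓ (mkV (suc zero) (suc (suc zero)) _) = (- 1ℚ) • ℓ (v (# 0) (# 3))
σℓ (mkV zero (suc (suc (suc zero))) _) = (- 1ℚ) • ℓ (v (# 1) (# 2))
σℓ (mkV (suc zero) (suc (suc (suc zero))) _) = (- 1ℚ) • ℓ (v (# 0) (# 2))
σℓ (mkV zero (suc (suc zero)) _) = (- 1ℚ) • ℓ (v (# 1) (# 3))
-- σ(ℓ_b) = ℓ_b for b ∈ {15,25,35,45} (the only remaining vertices)
σℓ b = ℓ b

σ : V → V
σ = linExt σℓ

private
  inj : (π : Permutation′ 5) {i j : Fin 5} → π ⟨$⟩ʳ i ≡ π ⟨$⟩ʳ j → i ≡ j
  inj π {i} {j} e = trans (sym (inverseˡ π)) (trans (cong (π ⟨$⟩ˡ_) e) (inverseˡ π))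

actV : Permutation′ 5 → Vertex → Vertex
actV π (mkV i j p) with <-cmp (π ⟨$⟩ʳ i) (π ⟨$⟩ʳ j)
... | tri< q _ _ = mkV (π ⟨$⟩ʳ i) (π ⟨$⟩ʳ j) q
... | tri≈ _ e _ = ⊥-elim (<-irrefl (inj π e) p)
... | tri> _ _ q = mkV (π ⟨$⟩ʳ j) (π ⟨$⟩ʳ i) q

permV : Permutation′ 5 → V → V
permV π = linExt (λ b → ℓ (actV π b))

InIm : V → Set
InIm u = ∃ λ w → u ≈ oneMinusA w

InKer : V → Set
InKer u = oneMinusA u ≈ zeroV

sum5 : (Fin 5 → ℚ) → (Fin 5 → V) → V
sum5 c e = sumL (# 0 ∷ # 1 ∷ # 2 ∷ # 3 ∷ # 4 ∷ []) (λ k → c k • e k)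

HasDim5 : (V → Set) → Set
HasDim5 S = Σ (Fin 5 → V) λ e →
    (∀ k → S (e k))
  × (∀ (c : Fin 5 → ℚ) → sum5 c e ≈ zeroV → ∀ k → c k ≡ 0ℚ)
  × (∀ u → S u → ∃ λ (c : Fin 5 → ℚ) → u ≈ sum5 c e)

{-# OPTIONS --safe #-}
module Submission where

open import Defs
open import Data.Fin using (Fin; #_)
open import Data.Fin.Permutation using (Permutation′; _⟨$⟩ʳ_)
open import Data.Rational using (ℚ; 0ℚ; _+_)
open import Data.Product using (∃; _×_)
open import Relation.Binary.PropositionalEquality using (_≡_)

open import Data.Bool using (if_then_else_)
open import Data.Empty using (⊥-elim)
open import Data.Fin using (suc)
open import Data.Fin.Patterns using (0F; 1F; 2F; 3F; 4F)
open import Data.Fin.Permutation using (_⟨$⟩ˡ_; inverseʳ)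
open import Data.Fin.Properties using (<-cmp; <-irrefl; <-irrelevant; all?) renaming (_≟_ to _≟F_)
import Data.Integer as ℤ
open import Data.List using (List; []; _∷_; foldr; allFin)
open import Data.List.Membership.Propositional using (_∈_)
open import Data.List.Membership.Propositional.Properties using (∈-allFin)
open import Data.List.Membership.DecPropositional using () renaming (_∈?_ to member?)
open import Data.List.Relation.Unary.All as All using (All; []; _∷_)
open import Data.List.Relation.Unary.Any as Any using (here; there)
open import Data.List.Relation.Unary.AllPairs using (_∷_)
open import Data.List.Relation.Unary.Unique.Propositional using (Unique)
open import Data.List.Relation.Unary.Unique.Propositional.Properties using (allFin⁺)
open import Data.List.Relation.Unary.Unique.DecPropositional using (unique?)
open import Data.Nat using (s≤s)
open import Data.Product using (_,_; proj₁; proj₂)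
open import Data.Rational using (1ℚ; _*_; -_; _-_; _/_)
open import Data.Rational.Properties
  using (+-identityʳ; +-inverseʳ; *-zeroˡ; *-zeroʳ; *-comm; *-assoc; *-distribˡ-+; *-distribʳ-+)
  renaming (_≟_ to _≟ℚ_)
open import Data.Rational.Solver using (module +-*-Solver)
open import Data.Sum as Sum using (_⊎_)
open import Function using (_∘_; id; _⇔_; mk⇔; Equivalence)
open import Function.Bundles using (Injection)
open import Function.Properties.Inverse using (↔⇒↣)
open import Relation.Binary using (Setoid; tri<; tri≈; tri>)
open import Relation.Binary.Definitions using (DecidableEquality)
open import Relation.Binary.PropositionalEquality using (refl; sym; trans; cong; cong₂; subst; module ≡-Reasoning)
import Relation.Binary.Reasoning.Setoid
open import Relation.Nullary using (Dec; does; yes; no; ¬_)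
open import Relation.Nullary.Decidable using (map′; _×-dec_; _⊎-dec_; _→-dec_; ¬?; from-yes; dec-true; dec-false)
open import Relation.Unary using (Decidable)

open +-*-Solver using (solve; _:=_; _:+_; _:*_; _:-_; :-_; con)

-- The Petersen graph is strongly regular with parameters (10, 3, 0, 1): for B = 1 − A and the
-- all-ones operator J this says B² = 3B + J and BJ = JB = −2J. Hence Q = (2B + J)/6 is the
-- projection onto Im B along Ker B, and X = (4 − J)/12 satisfies BX = XB = Q, which gives
-- V = Im B ⊕ Ker B. Each summand gets an explicit echelon basis; a vector of the summand is the
-- combination of that basis read off at the pivots, because Q (resp. 1 − Q) maps every ℓ_b into
-- its span. σ maps each basis vector back into its summand. Finally σ ℓ_c = ℓ_c when 5 ∈ c and
-- σ ℓ_c = −ℓ_d when c ⊔ d = {1,2,3,4}; both descriptions are stable under the permutations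
-- fixing 5, so σ commutes with them.

v₁₂ v₁₃ v₁₄ v₁₅ v₂₃ v₂₄ v₂₅ v₃₄ v₃₅ v₄₅ : Vertex
v₁₂ = v (# 0) (# 1)
v₁₃ = v (# 0) (# 2)
v₁₄ = v (# 0) (# 3)
v₁₅ = v (# 0) (# 4)
v₂₃ = v (# 1) (# 2)
v₂₄ = v (# 1) (# 3)
v₂₅ = v (# 1) (# 4)
v₃₄ = v (# 2) (# 3)
v₃₅ = v (# 2) (# 4)
v₄₅ = v (# 3) (# 4)

≡-vertex : ∀ {a b} → fst a ≡ fst b → snd a ≡ snd b → a ≡ b
≡-vertex {mkV i j p} {mkV .i .j q} refl refl = cong (mkV i j) (<-irrelevant p q)

-- `does (a ≟V b)` is `a == b` by definition, so `ℓ b a` is a Kronecker delta.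
_≟V_ : DecidableEquality Vertex
a ≟V b = map′ (λ (e₁ , e₂) → ≡-vertex e₁ e₂) (λ { refl → refl , refl })
              ((fst a ≟F fst b) ×-dec (snd a ≟F snd b))

allV-unique : Unique allV
allV-unique = from-yes (unique? _≟V_ allV)

∈-allV : ∀ a → a ∈ allV
∈-allV (mkV _ 0F ())
∈-allV a@(mkV 0F 1F _) = from-yes (member? _≟V_ a allV)
∈-allV (mkV (suc _) 1F (s≤s ()))
∈-allV a@(mkV 0F 2F _) = from-yes (member? _≟V_ a allV)
∈-allV a@(mkV 1F 2F _) = from-yes (member? _≟V_ a allV)
∈-allV (mkV (suc (suc _)) 2F (s≤s (s≤s ())))
∈-allV a@(mkV 0F 3F _) = from-yes (member? _≟V_ a allV)
∈-allV a@(mkV 1F 3F _) = from-yes (member? _≟V_ a allV)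
∈-allV a@(mkV 2F 3F _) = from-yes (member? _≟V_ a allV)
∈-allV (mkV (suc (suc (suc _))) 3F (s≤s (s≤s (s≤s ()))))
∈-allV a@(mkV 0F 4F _) = from-yes (member? _≟V_ a allV)
∈-allV a@(mkV 1F 4F _) = from-yes (member? _≟V_ a allV)
∈-allV a@(mkV 2F 4F _) = from-yes (member? _≟V_ a allV)
∈-allV a@(mkV 3F 4F _) = from-yes (member? _≟V_ a allV)
∈-allV (mkV (suc (suc (suc (suc _)))) 4F (s≤s (s≤s (s≤s (s≤s ())))))

∀-vertex? : ∀ {P : Vertex → Set} → Decidable P → Dec (∀ a → P a)
∀-vertex? P? = map′ (λ ps a → All.lookup ps (∈-allV a)) (λ f → All.tabulate (λ {a} _ → f a))
                    (All.all? P? allV)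

∃-vertex? : ∀ {P : Vertex → Set} → Decidable P → Dec (∃ P)
∃-vertex? P? = map′ Any.satisfied (λ (a , pa) → Any.map (λ { refl → pa }) (∈-allV a))
                    (Any.any? P? allV)

_≈?_ : (u w : V) → Dec (u ≈ w)
u ≈? w = ∀-vertex? (λ a → u a ≟ℚ w a)

infix 4 _∈ᵛ_ _∈ᵛ?_

_∈ᵛ_ : Fin 5 → Vertex → Set
i ∈ᵛ a = i ≡ fst a ⊎ i ≡ snd a

_∈ᵛ?_ : ∀ i a → Dec (i ∈ᵛ a)
i ∈ᵛ? a = (i ≟F fst a) ⊎-dec (i ≟F snd a)

Σ : {I : Set} → List I → (I → ℚ) → ℚ
Σ xs g = foldr (λ i s → g i + s) 0ℚ xs

Σ-cong : ∀ {I} (xs : List I) {g h : I → ℚ} → (∀ i → g i ≡ h i) → Σ xs g ≡ Σ xs h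
Σ-cong []       eq = refl
Σ-cong (x ∷ xs) eq = cong₂ _+_ (eq x) (Σ-cong xs eq)

module Kronecker {I : Set} (_≟_ : DecidableEquality I) where

  δ : I → I → ℚ
  δ i j = if does (i ≟ j) then 1ℚ else 0ℚ

  δ-diag : ∀ i → δ i i ≡ 1ℚ
  δ-diag i rewrite dec-true (i ≟ i) refl = refl

  δ-off : ∀ {i j} → ¬ i ≡ j → δ i j ≡ 0ℚ
  δ-off {i} {j} i≢j rewrite dec-false (i ≟ j) i≢j = refl

  δ-sym : ∀ i j → δ i j ≡ δ j i
  δ-sym i j with i ≟ j | j ≟ i
  ... | yes _   | yes _   = refl
  ... | no  _   | no  _   = refl
  ... | yes i≡j | no  j≢i = ⊥-elim (j≢i (sym i≡j))
  ... | no  i≢j | yes j≡i = ⊥-elim (i≢j (sym j≡i))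

  Σ-δ-absent : ∀ {xs} (c : I → ℚ) {j} → All (λ i → ¬ j ≡ i) xs → Σ xs (λ i → c i * δ i j) ≡ 0ℚ
  Σ-δ-absent c []           = refl
  Σ-δ-absent c (j≢x ∷ j∉xs) = trans (cong₂ (λ d s → c _ * d + s) (δ-off (j≢x ∘ sym)) (Σ-δ-absent c j∉xs))
                                     (solve 1 (λ x → x :* con 0ℚ :+ con 0ℚ := con 0ℚ) refl (c _))

  Σ-δ : ∀ {xs} (c : I → ℚ) {j} → Unique xs → j ∈ xs → Σ xs (λ i → c i * δ i j) ≡ c j
  Σ-δ c (x∉xs ∷ _) (here refl) = trans (cong₂ (λ d s → c _ * d + s) (δ-diag _) (Σ-δ-absent c x∉xs))
                                        (solve 1 (λ x → x :* con 1ℚ :+ con 0ℚ := x) refl (c _))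
  Σ-δ c (x∉xs ∷ xs-unique) (there j∈xs) =
    trans (cong₂ (λ d s → c _ * d + s) (δ-off (All.lookup x∉xs j∈xs)) (Σ-δ c xs-unique j∈xs))
          (solve 2 (λ x y → x :* con 0ℚ :+ y := y) refl (c _) _)

open Kronecker (_≟F_ {5}) using (δ)

≈-setoid : Setoid _ _
≈-setoid = record
  { Carrier       = V
  ; _≈_           = _≈_
  ; isEquivalence = record
    { refl  = λ _ → refl
    ; sym   = λ u≈w a → sym (u≈w a)
    ; trans = λ u≈v v≈w a → trans (u≈v a) (v≈w a)
    }
  }

open Setoid ≈-setoid using () renaming (sym to ≈-sym; trans to ≈-trans)
module ≈-Reasoning = Relation.Binary.Reasoning.Setoid ≈-setoid

combine : {I : Set} → List I → (I → V) → (I → ℚ) → V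
combine xs g c = sumL xs (λ i → c i • g i)

sumL-cong : ∀ {I} (xs : List I) {f g : I → V} → (∀ i → f i ≈ g i) → sumL xs f ≈ sumL xs g
sumL-cong []       eq a = refl
sumL-cong (x ∷ xs) eq a = cong₂ _+_ (eq x a) (sumL-cong xs eq a)

sumL-+ : ∀ {I} (xs : List I) (f g : I → V) → sumL xs (λ i → f i +V g i) ≈ (sumL xs f +V sumL xs g)
sumL-+ []       f g a = sym (+-identityʳ 0ℚ)
sumL-+ (x ∷ xs) f g a = trans (cong ((f x a + g x a) +_) (sumL-+ xs f g a))
  (solve 4 (λ p q r s → (p :+ q) :+ (r :+ s) := (p :+ r) :+ (q :+ s)) refl (f x a) (g x a) _ _)

sumL-• : ∀ {I} (xs : List I) s (f : I → V) → sumL xs (λ i → s • f i) ≈ (s • sumL xs f)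
sumL-• []       s f a = sym (*-zeroʳ s)
sumL-• (x ∷ xs) s f a = trans (cong (s * f x a +_) (sumL-• xs s f a)) (sym (*-distribˡ-+ s _ _))

combine-zeroV : ∀ {I} (xs : List I) c → combine xs (λ _ → zeroV) c ≈ zeroV
combine-zeroV []       c a = refl
combine-zeroV (x ∷ xs) c a = trans (cong (c x * 0ℚ +_) (combine-zeroV xs c a))
  (solve 1 (λ x → x :* con 0ℚ :+ con 0ℚ := con 0ℚ) refl (c x))

record IsLinear (L : V → V) : Set where
  field
    congruent   : ∀ {u w} → u ≈ w → L u ≈ L w
    additive    : ∀ u w → L (u +V w) ≈ (L u +V L w)
    homogeneous : ∀ s u → L (s • u) ≈ (s • L u)

  zero-preserving : L zeroV ≈ zeroV
  zero-preserving a = trans (congruent (λ b → sym (*-zeroˡ 0ℚ)) a)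
                            (trans (homogeneous 0ℚ zeroV a) (*-zeroˡ (L zeroV a)))

  subtractive : ∀ u w → L (u -V w) ≈ (L u -V L w)
  subtractive u w a = begin
    L (u -V w) a                 ≡⟨ congruent (λ b → cong (u b +_) (neg≡-1* (w b))) a ⟩
    L (u +V ((- 1ℚ) • w)) a      ≡⟨ additive u _ a ⟩
    L u a + L ((- 1ℚ) • w) a     ≡⟨ cong (L u a +_) (homogeneous (- 1ℚ) w a) ⟩
    L u a + (- 1ℚ) * L w a       ≡⟨ cong (L u a +_) (neg≡-1* (L w a)) ⟨
    L u a - L w a                ∎
    where
    open ≡-Reasoning
    neg≡-1* : ∀ x → - x ≡ (- 1ℚ) * x
    neg≡-1* = solve 1 (λ x → :- x := con (- 1ℚ) :* x) refl

  sumL-homo : ∀ {I} (xs : List I) (f : I → V) → L (sumL xs f) ≈ sumL xs (L ∘ f)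
  sumL-homo []       f = zero-preserving
  sumL-homo (x ∷ xs) f a = trans (additive (f x) (sumL xs f) a) (cong (L (f x) a +_) (sumL-homo xs f a))

  combine-homo : ∀ {I} (xs : List I) (g : I → V) (c : I → ℚ) → L (combine xs g c) ≈ combine xs (L ∘ g) c
  combine-homo xs g c = ≈-trans (sumL-homo xs _) (sumL-cong xs (λ i → homogeneous (c i) (g i)))

open IsLinear

id-linear : IsLinear id
id-linear = record { congruent = id ; additive = λ _ _ _ → refl ; homogeneous = λ _ _ _ → refl }

∘-linear : ∀ {L M} → IsLinear L → IsLinear M → IsLinear (L ∘ M)
∘-linear L-lin M-lin = record
  { congruent   = congruent L-lin ∘ congruent M-lin
  ; additive    = λ u w → ≈-trans (congruent L-lin (additive M-lin u w)) (additive L-lin _ _)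
  ; homogeneous = λ s u → ≈-trans (congruent L-lin (homogeneous M-lin s u)) (homogeneous L-lin s _)
  }

+V-linear : ∀ {L M} → IsLinear L → IsLinear M → IsLinear (λ u → L u +V M u)
+V-linear {L} {M} L-lin M-lin = record
  { congruent   = λ u≈w a → cong₂ _+_ (congruent L-lin u≈w a) (congruent M-lin u≈w a)
  ; additive    = λ u w a → trans (cong₂ _+_ (additive L-lin u w a) (additive M-lin u w a))
      (solve 4 (λ p q r s → (p :+ q) :+ (r :+ s) := (p :+ r) :+ (q :+ s)) refl (L u a) (L w a) (M u a) (M w a))
  ; homogeneous = λ s u a → trans (cong₂ _+_ (homogeneous L-lin s u a) (homogeneous M-lin s u a))
      (sym (*-distribˡ-+ s (L u a) (M u a)))
  }

-V-linear : ∀ {L M} → IsLinear L → IsLinear M → IsLinear (λ u → L u -V M u)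
-V-linear {L} {M} L-lin M-lin = record
  { congruent   = λ u≈w a → cong₂ _-_ (congruent L-lin u≈w a) (congruent M-lin u≈w a)
  ; additive    = λ u w a → trans (cong₂ _-_ (additive L-lin u w a) (additive M-lin u w a))
      (solve 4 (λ p q r s → (p :+ q) :- (r :+ s) := (p :- r) :+ (q :- s)) refl (L u a) (L w a) (M u a) (M w a))
  ; homogeneous = λ s u a → trans (cong₂ _-_ (homogeneous L-lin s u a) (homogeneous M-lin s u a))
      (solve 3 (λ s x y → s :* x :- s :* y := s :* (x :- y)) refl s (L u a) (M u a))
  }

•-linear : ∀ {L} s → IsLinear L → IsLinear (λ u → s • L u)
•-linear {L} s L-lin = record
  { congruent   = λ u≈w a → cong (s *_) (congruent L-lin u≈w a)
  ; additive    = λ u w a → trans (cong (s *_) (additive L-lin u w a)) (*-distribˡ-+ s (L u a) (L w a))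
  ; homogeneous = λ t u a → trans (cong (s *_) (homogeneous L-lin t u a))
      (solve 3 (λ s t x → s :* (t :* x) := t :* (s :* x)) refl s t (L u a))
  }

combine-linear : ∀ {I} (xs : List I) (g : I → V) (p : I → Vertex) → IsLinear (λ u → combine xs g (u ∘ p))
combine-linear xs g p = record
  { congruent   = λ u≈w → sumL-cong xs (λ i a → cong (_* g i a) (u≈w (p i)))
  ; additive    = λ u w → ≈-trans (sumL-cong xs (λ i a → *-distribʳ-+ (g i a) (u (p i)) (w (p i)))) (sumL-+ xs (λ i → u (p i) • g i) (λ i → w (p i) • g i))
  ; homogeneous = λ s u → ≈-trans (sumL-cong xs (λ i a → *-assoc s (u (p i)) (g i a))) (sumL-• xs s (λ i → u (p i) • g i))
  }

linExt-linear : ∀ f → IsLinear (linExt f)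
linExt-linear f = combine-linear allV f id

linExt-ℓ : ∀ f c → linExt f (ℓ c) ≈ f c
linExt-ℓ f c a = trans (Σ-cong allV {g = λ b → ℓ c b * f b a} (λ b → *-comm (ℓ c b) (f b a)))
                       (Kronecker.Σ-δ _≟V_ (λ b → f b a) allV-unique (∈-allV c))

expand : ∀ u → u ≈ linExt ℓ u
expand u a = sym (trans (Σ-cong allV {g = λ b → u b * ℓ b a} (λ b → cong (u b *_) (Kronecker.δ-sym _≟V_ a b)))
                        (Kronecker.Σ-δ _≟V_ u allV-unique (∈-allV a)))

linear-ext : ∀ {L M} → IsLinear L → IsLinear M → (∀ b → L (ℓ b) ≈ M (ℓ b)) → ∀ u → L u ≈ M u
linear-ext {L} {M} L-lin M-lin agree u = begin
  L u                 ≈⟨ congruent L-lin (expand u) ⟩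
  L (linExt ℓ u)      ≈⟨ combine-homo L-lin allV ℓ u ⟩
  linExt (L ∘ ℓ) u    ≈⟨ sumL-cong allV (λ b a → cong (u b *_) (agree b a)) ⟩
  linExt (M ∘ ℓ) u    ≈⟨ combine-homo M-lin allV ℓ u ⟨
  M (linExt ℓ u)      ≈⟨ congruent M-lin (expand u) ⟨
  M u                 ∎
  where open ≈-Reasoning

-- The Petersen identities and the projection onto Im B

2ℚ 3ℚ : ℚ
2ℚ = ℤ.+ 2 / 1
3ℚ = ℤ.+ 3 / 1

B : V → V
B = oneMinusA

J : V → V
J = linExt (λ _ _ → 1ℚ)

B-linear : IsLinear B
B-linear = -V-linear id-linear (linExt-linear Aℓ)

J-linear : IsLinear J
J-linear = linExt-linear (λ _ _ → 1ℚ)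

-- A² + A − 2 = J: adjacent vertices have no common neighbour, non-adjacent ones exactly one.
B²≈3B+J : ∀ u → B (B u) ≈ ((3ℚ • B u) +V J u)
B²≈3B+J = linear-ext (∘-linear B-linear B-linear) (+V-linear (•-linear 3ℚ B-linear) J-linear)
  (from-yes (∀-vertex? λ b → B (B (ℓ b)) ≈? ((3ℚ • B (ℓ b)) +V J (ℓ b))))

BJ≈-2J : ∀ u → B (J u) ≈ ((- 2ℚ) • J u)
BJ≈-2J = linear-ext (∘-linear B-linear J-linear) (•-linear (- 2ℚ) J-linear)
  (from-yes (∀-vertex? λ b → B (J (ℓ b)) ≈? ((- 2ℚ) • J (ℓ b))))

JB≈-2J : ∀ u → J (B u) ≈ ((- 2ℚ) • J u)
JB≈-2J = linear-ext (∘-linear J-linear B-linear) (•-linear (- 2ℚ) J-linear)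
  (from-yes (∀-vertex? λ b → J (B (ℓ b)) ≈? ((- 2ℚ) • J (ℓ b))))

⅓ ⅙ ⅟₁₂ : ℚ
⅓   = ℤ.+ 1 / 3
⅙   = ℤ.+ 1 / 6
⅟₁₂ = ℤ.+ 1 / 12

-- 1 on the A-eigenspaces for 3 and −2, and 0 on the one for 1.
Q : V → V
Q u = (⅓ • B u) +V (⅙ • J u)

-- X inverts B on Im B: BX = XB = Q.
X : V → V
X u = (⅓ • u) -V (⅟₁₂ • J u)

Q-linear : IsLinear Q
Q-linear = +V-linear (•-linear ⅓ B-linear) (•-linear ⅙ J-linear)

X-linear : IsLinear X
X-linear = -V-linear (•-linear ⅓ id-linear) (•-linear ⅟₁₂ J-linear)

QB≈B : ∀ u → Q (B u) ≈ B u
QB≈B u a = trans (cong₂ (λ x y → ⅓ * x + ⅙ * y) (B²≈3B+J u a) (JB≈-2J u a))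
  (solve 2 (λ x y → con ⅓ :* (con 3ℚ :* x :+ y) :+ con ⅙ :* (con (- 2ℚ) :* y) := x)
         refl (B u a) (J u a))

private
  X-Q-coefficients : ∀ x y → ⅓ * x - ⅟₁₂ * ((- 2ℚ) * y) ≡ ⅓ * x + ⅙ * y
  X-Q-coefficients = solve 2 (λ x y → con ⅓ :* x :- con ⅟₁₂ :* (con (- 2ℚ) :* y)
                         := con ⅓ :* x :+ con ⅙ :* y) refl

BX≈Q : ∀ u → B (X u) ≈ Q u
BX≈Q u a = begin
  B (X u) a                                 ≡⟨ subtractive B-linear (⅓ • u) (⅟₁₂ • J u) a ⟩
  B (⅓ • u) a - B (⅟₁₂ • J u) a             ≡⟨ cong₂ _-_ (homogeneous B-linear ⅓ u a) (homogeneous B-linear ⅟₁₂ (J u) a) ⟩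
  ⅓ * B u a - ⅟₁₂ * B (J u) a               ≡⟨ cong (λ y → ⅓ * B u a - ⅟₁₂ * y) (BJ≈-2J u a) ⟩
  ⅓ * B u a - ⅟₁₂ * ((- 2ℚ) * J u a)        ≡⟨ X-Q-coefficients (B u a) (J u a) ⟩
  Q u a                                     ∎
  where open ≡-Reasoning

XB≈Q : ∀ u → X (B u) ≈ Q u
XB≈Q u a = trans (cong (λ y → ⅓ * B u a - ⅟₁₂ * y) (JB≈-2J u a)) (X-Q-coefficients (B u a) (J u a))

BQ≈B : ∀ u → B (Q u) ≈ B u
BQ≈B u = begin
  B (Q u)      ≈⟨ congruent B-linear (XB≈Q u) ⟨
  B (X (B u))  ≈⟨ BX≈Q (B u) ⟩
  Q (B u)      ≈⟨ QB≈B u ⟩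
  B u          ∎
  where open ≈-Reasoning

Q-image : ∀ u → InIm (Q u)
Q-image u = X u , ≈-sym (BX≈Q u)

Q-fixed⇒image : ∀ u → Q u ≈ u → InIm u
Q-fixed⇒image u Qu≈u = X u , ≈-trans (≈-sym Qu≈u) (≈-sym (BX≈Q u))

image⇒Q-fixed : ∀ u → InIm u → u ≈ Q u
image⇒Q-fixed u (w , u≈Bw) = begin
  u        ≈⟨ u≈Bw ⟩
  B w      ≈⟨ QB≈B w ⟨
  Q (B w)  ≈⟨ congruent Q-linear u≈Bw ⟨
  Q u      ∎
  where open ≈-Reasoning

kernel⇒Q≈0 : ∀ u → InKer u → Q u ≈ zeroV
kernel⇒Q≈0 u Bu≈0 = begin
  Q u          ≈⟨ XB≈Q u ⟨
  X (B u)      ≈⟨ congruent X-linear Bu≈0 ⟩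
  X zeroV      ≈⟨ zero-preserving X-linear ⟩
  zeroV        ∎
  where open ≈-Reasoning

image∩kernel≈0 : ∀ u → InIm u → InKer u → u ≈ zeroV
image∩kernel≈0 u u∈Im u∈Ker = ≈-trans (image⇒Q-fixed u u∈Im) (kernel⇒Q≈0 u u∈Ker)

image⊕kernel : ∀ u → ∃ λ w → ∃ λ k → InIm w × InKer k × u ≈ (w +V k)
image⊕kernel u = Q u , (u -V Q u) , Q-image u , B[u-Qu]≈0 , u≈Qu+[u-Qu]
  where
  B[u-Qu]≈0 : InKer (u -V Q u)
  B[u-Qu]≈0 a = trans (subtractive B-linear u (Q u) a)
                      (trans (cong (λ y → B u a - y) (BQ≈B u a)) (+-inverseʳ (B u a)))
  u≈Qu+[u-Qu] : u ≈ (Q u +V (u -V Q u))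
  u≈Qu+[u-Qu] a = solve 2 (λ x y → x := y :+ (x :- y)) refl (u a) (Q u a)

-- Echelon bases of Im B and Ker B

fins : List (Fin 5)
fins = allFin 5

record IsSubspace (S : V → Set) : Set₁ where
  field
    respects       : ∀ {u w} → u ≈ w → S u → S w
    combine-closed : ∀ {I : Set} (xs : List I) (g : I → V) c → (∀ i → S (g i)) → S (combine xs g c)

open IsSubspace

kernel-isSubspace : ∀ {L} → IsLinear L → IsSubspace (λ u → L u ≈ zeroV)
kernel-isSubspace L-lin = record
  { respects       = λ u≈w Lu≈0 → ≈-trans (congruent L-lin (≈-sym u≈w)) Lu≈0
  ; combine-closed = λ xs g c Lg≈0 → ≈-trans (combine-homo L-lin xs g c)
      (≈-trans (sumL-cong xs (λ i a → cong (c i *_) (Lg≈0 i a))) (combine-zeroV xs c))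
  }

image-isSubspace : ∀ {L} → IsLinear L → IsSubspace (λ u → ∃ λ w → u ≈ L w)
image-isSubspace L-lin = record
  { respects       = λ { u≈w (x , u≈Lx) → x , ≈-trans (≈-sym u≈w) u≈Lx }
  ; combine-closed = λ xs g c g≈Lw → combine xs (proj₁ ∘ g≈Lw) c
      , ≈-trans (sumL-cong xs (λ i a → cong (c i *_) (proj₂ (g≈Lw i) a))) (≈-sym (combine-homo L-lin xs _ c))
  }

module _ (e : Fin 5 → V) (p : Fin 5 → Vertex) (pivots : ∀ k j → e k (p j) ≡ δ k j) where

  sum5-at-pivot : ∀ c j → sum5 c e (p j) ≡ c j
  sum5-at-pivot c j = trans (Σ-cong fins {g = λ k → c k * e k (p j)} (λ k → cong (c k *_) (pivots k j)))
                            (Kronecker.Σ-δ _≟F_ c (allFin⁺ 5) (∈-allFin j))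

  echelon-independent : ∀ c → sum5 c e ≈ zeroV → ∀ k → c k ≡ 0ℚ
  echelon-independent c ce≈0 k = trans (sym (sum5-at-pivot c k)) (ce≈0 (p k))

  echelon-spans : ∀ {S : V → Set} {R} → IsLinear R → (∀ u → S u → u ≈ R u)
    → (∀ b → R (ℓ b) ≈ sum5 (λ k → R (ℓ b) (p k)) e) → ∀ u → S u → ∃ λ c → u ≈ sum5 c e
  echelon-spans {R = R} R-lin fixes R-basis u u∈S = (λ k → R u (p k))
    , ≈-trans (fixes u u∈S) (linear-ext R-lin (∘-linear (combine-linear fins e p) R-lin) R-basis u)

invariant-by-spanning : ∀ {S T} → IsSubspace S → IsLinear T → (e : Fin 5 → V)
  → (∀ u → S u → ∃ λ c → u ≈ sum5 c e) → (∀ k → S (T (e k))) → ∀ u → S u → S (T u)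
invariant-by-spanning S-sub T-lin e spans Te∈S u u∈S =
  let c , u≈ce = spans u u∈S
  in  respects S-sub (≈-sym (≈-trans (congruent T-lin u≈ce) (combine-homo T-lin fins e c)))
                     (combine-closed S-sub fins _ c Te∈S)

star : Fin 5 → V
star i b = if does (i ∈ᵛ? b) then 1ℚ else 0ℚ

imPivot : Fin 5 → Vertex
imPivot 0F = v₁₂
imPivot 1F = v₁₃
imPivot 2F = v₁₄
imPivot 3F = v₁₅
imPivot 4F = v₂₃

imBasis : Fin 5 → V
imBasis 0F = B (ℓ v₁₂)
imBasis 1F = B (ℓ v₁₃)
imBasis 2F = star (# 3)
imBasis 3F = star (# 4)
imBasis 4F = (λ _ → 1ℚ) -V star (# 0)

imBasis-fixed : ∀ k → Q (imBasis k) ≈ imBasis k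
imBasis-fixed = from-yes (all? λ k → Q (imBasis k) ≈? imBasis k)

imBasis-pivots : ∀ k j → imBasis k (imPivot j) ≡ δ k j
imBasis-pivots = from-yes (all? λ k → all? λ j → imBasis k (imPivot j) ≟ℚ δ k j)

image-spanned : ∀ u → InIm u → ∃ λ c → u ≈ sum5 c imBasis
image-spanned = echelon-spans imBasis imPivot imBasis-pivots Q-linear image⇒Q-fixed
  (from-yes (∀-vertex? λ b → Q (ℓ b) ≈? sum5 (λ k → Q (ℓ b) (imPivot k)) imBasis))

image-hasDim5 : HasDim5 InIm
image-hasDim5 = imBasis , (λ k → Q-fixed⇒image (imBasis k) (imBasis-fixed k))
              , echelon-independent imBasis imPivot imBasis-pivots , image-spanned

-- For a b c d = ik il jk jl, the polytabloid of the tableau with columns {i,j}, {k,l};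
-- these span the Specht module V₃₂ = Ker B.
polytabloid : Vertex → Vertex → Vertex → Vertex → V
polytabloid a b c d = (ℓ a -V ℓ b) -V (ℓ c -V ℓ d)

kerPivot : Fin 5 → Vertex
kerPivot 0F = v₁₂
kerPivot 1F = v₁₃
kerPivot 2F = v₁₄
kerPivot 3F = v₂₃
kerPivot 4F = v₂₅

kerBasis : Fin 5 → V
kerBasis 0F = polytabloid v₁₂ v₁₅ v₂₄ v₄₅
kerBasis 1F = polytabloid v₁₃ v₁₅ v₃₄ v₄₅
kerBasis 2F = polytabloid v₁₄ v₁₅ v₃₄ v₃₅
kerBasis 3F = polytabloid v₂₃ v₂₄ v₃₅ v₄₅
kerBasis 4F = polytabloid v₂₅ v₂₄ v₃₅ v₃₄

kerBasis-kernel : ∀ k → InKer (kerBasis k)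
kerBasis-kernel = from-yes (all? λ k → B (kerBasis k) ≈? zeroV)

kerBasis-pivots : ∀ k j → kerBasis k (kerPivot j) ≡ δ k j
kerBasis-pivots = from-yes (all? λ k → all? λ j → kerBasis k (kerPivot j) ≟ℚ δ k j)

P : V → V
P u = u -V Q u

P-linear : IsLinear P
P-linear = -V-linear id-linear Q-linear

kernel⇒P-fixed : ∀ u → InKer u → u ≈ P u
kernel⇒P-fixed u Bu≈0 a = sym (trans (cong (λ y → u a - y) (kernel⇒Q≈0 u Bu≈0 a))
                                   (solve 1 (λ x → x :- con 0ℚ := x) refl (u a)))

kernel-spanned : ∀ u → InKer u → ∃ λ c → u ≈ sum5 c kerBasis
kernel-spanned = echelon-spans kerBasis kerPivot kerBasis-pivots P-linear kernel⇒P-fixed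
  (from-yes (∀-vertex? λ b → P (ℓ b) ≈? sum5 (λ k → P (ℓ b) (kerPivot k)) kerBasis))

kernel-hasDim5 : HasDim5 InKer
kernel-hasDim5 = kerBasis , kerBasis-kernel , echelon-independent kerBasis kerPivot kerBasis-pivots , kernel-spanned

-- The symmetries of σ

σ-linear : IsLinear σ
σ-linear = linExt-linear σℓ

σ-imBasis-fixed : ∀ k → Q (σ (imBasis k)) ≈ σ (imBasis k)
σ-imBasis-fixed = from-yes (all? λ k → Q (σ (imBasis k)) ≈? σ (imBasis k))

σ-kerBasis-kernel : ∀ k → InKer (σ (kerBasis k))
σ-kerBasis-kernel = from-yes (all? λ k → B (σ (kerBasis k)) ≈? zeroV)

σ-image : ∀ u → InIm u → InIm (σ u)
σ-image = invariant-by-spanning (image-isSubspace B-linear) σ-linear imBasis image-spanned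
  (λ k → Q-fixed⇒image (σ (imBasis k)) (σ-imBasis-fixed k))

σ-kernel : ∀ u → InKer u → InKer (σ u)
σ-kernel = invariant-by-spanning (kernel-isSubspace B-linear) σ-linear kerBasis kernel-spanned σ-kerBasis-kernel

Complementary : Vertex → Vertex → Set
Complementary c d = ¬ # 4 ∈ᵛ c × ¬ # 4 ∈ᵛ d × (∀ i → i ∈ᵛ c → ¬ i ∈ᵛ d)

complementary? : ∀ c d → Dec (Complementary c d)
complementary? c d = ¬? (# 4 ∈ᵛ? c) ×-dec ¬? (# 4 ∈ᵛ? d) ×-dec all? (λ i → i ∈ᵛ? c →-dec ¬? (i ∈ᵛ? d))

σℓ-fixes : ∀ c → # 4 ∈ᵛ c → σℓ c ≈ ℓ c
σℓ-fixes = from-yes (∀-vertex? λ c → # 4 ∈ᵛ? c →-dec σℓ c ≈? ℓ c)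

σℓ-swaps : ∀ c d → Complementary c d → σℓ c ≈ ((- 1ℚ) • ℓ d)
σℓ-swaps = from-yes (∀-vertex? λ c → ∀-vertex? λ d → complementary? c d →-dec σℓ c ≈? ((- 1ℚ) • ℓ d))

complement : ∀ c → ¬ # 4 ∈ᵛ c → ∃ (Complementary c)
complement = from-yes (∀-vertex? λ c → ¬? (# 4 ∈ᵛ? c) →-dec ∃-vertex? (complementary? c))

module _ (π : Permutation′ 5) where

  private
    π-injective : ∀ {i j} → π ⟨$⟩ʳ i ≡ π ⟨$⟩ʳ j → i ≡ j
    π-injective = Injection.injective (↔⇒↣ π)

  ∈ᵛ-actV : ∀ c {i} → π ⟨$⟩ʳ i ∈ᵛ actV π c ⇔ i ∈ᵛ c
  ∈ᵛ-actV (mkV i j i<j) with <-cmp (π ⟨$⟩ʳ i) (π ⟨$⟩ʳ j)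
  ... | tri< _ _ _     = mk⇔ (Sum.map π-injective π-injective) (Sum.map (cong (π ⟨$⟩ʳ_)) (cong (π ⟨$⟩ʳ_)))
  ... | tri≈ _ πi≡πj _ = ⊥-elim (<-irrefl (π-injective πi≡πj) i<j)
  ... | tri> _ _ _     = mk⇔ (Sum.swap ∘ Sum.map π-injective π-injective)
                             (Sum.map (cong (π ⟨$⟩ʳ_)) (cong (π ⟨$⟩ʳ_)) ∘ Sum.swap)

  ∈ᵛ-actV⁻ : ∀ c {i} → i ∈ᵛ actV π c → π ⟨$⟩ˡ i ∈ᵛ c
  ∈ᵛ-actV⁻ c i∈πc = Equivalence.to (∈ᵛ-actV c) (subst (_∈ᵛ actV π c) (sym (inverseʳ π)) i∈πc)

  permV-linear : IsLinear (permV π)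
  permV-linear = linExt-linear (ℓ ∘ actV π)

  module _ (π5≡5 : π ⟨$⟩ʳ # 4 ≡ # 4) where

    5∈ᵛ-actV : ∀ c → # 4 ∈ᵛ actV π c ⇔ # 4 ∈ᵛ c
    5∈ᵛ-actV c = subst (λ i → i ∈ᵛ actV π c ⇔ # 4 ∈ᵛ c) π5≡5 (∈ᵛ-actV c)

    complementary-actV : ∀ {c d} → Complementary c d → Complementary (actV π c) (actV π d)
    complementary-actV {c} {d} (5∉c , 5∉d , c∩d=∅) =
        5∉c ∘ Equivalence.to (5∈ᵛ-actV c)
      , 5∉d ∘ Equivalence.to (5∈ᵛ-actV d)
      , λ i i∈πc i∈πd → c∩d=∅ _ (∈ᵛ-actV⁻ c i∈πc) (∈ᵛ-actV⁻ d i∈πd)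

    σℓ-actV-fixed : ∀ {c} → # 4 ∈ᵛ c → σℓ (actV π c) ≈ permV π (σℓ c)
    σℓ-actV-fixed {c} 5∈c = begin
      σℓ (actV π c)    ≈⟨ σℓ-fixes (actV π c) (Equivalence.from (5∈ᵛ-actV c) 5∈c) ⟩
      ℓ (actV π c)     ≈⟨ linExt-ℓ (ℓ ∘ actV π) c ⟨
      permV π (ℓ c)    ≈⟨ congruent permV-linear (σℓ-fixes c 5∈c) ⟨
      permV π (σℓ c)   ∎
      where open ≈-Reasoning

    σℓ-actV-complementary : ∀ {c} → ∃ (Complementary c) → σℓ (actV π c) ≈ permV π (σℓ c)
    σℓ-actV-complementary {c} (d , c|d) = begin
      σℓ (actV π c)              ≈⟨ σℓ-swaps (actV π c) (actV π d) (complementary-actV c|d) ⟩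
      ((- 1ℚ) • ℓ (actV π d))    ≈⟨ (λ a → cong ((- 1ℚ) *_) (linExt-ℓ (ℓ ∘ actV π) d a)) ⟨
      ((- 1ℚ) • permV π (ℓ d))   ≈⟨ homogeneous permV-linear (- 1ℚ) (ℓ d) ⟨
      permV π ((- 1ℚ) • ℓ d)     ≈⟨ congruent permV-linear (σℓ-swaps c d c|d) ⟨
      permV π (σℓ c)             ∎
      where open ≈-Reasoning

    σℓ-actV : ∀ c → σℓ (actV π c) ≈ permV π (σℓ c)
    σℓ-actV c with # 4 ∈ᵛ? c
    ... | yes 5∈c = σℓ-actV-fixed 5∈c
    ... | no  5∉c = σℓ-actV-complementary (complement c 5∉c)

    σ-permV : ∀ u → σ (permV π u) ≈ permV π (σ u)
    σ-permV = linear-ext (∘-linear σ-linear permV-linear) (∘-linear permV-linear σ-linear) λ c → begin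
      σ (permV π (ℓ c))  ≈⟨ congruent σ-linear (linExt-ℓ (ℓ ∘ actV π) c) ⟩
      σ (ℓ (actV π c))   ≈⟨ linExt-ℓ σℓ (actV π c) ⟩
      σℓ (actV π c)      ≈⟨ σℓ-actV c ⟩
      permV π (σℓ c)     ≈⟨ congruent permV-linear (linExt-ℓ σℓ c) ⟨
      permV π (σ (ℓ c))  ∎
      where open ≈-Reasoning

mainTheorem3 :
      (HasDim5 InIm × HasDim5 InKer)
    × ((∀ u → InIm u → InKer u → u ≈ zeroV)
       × (∀ u → ∃ λ w → ∃ λ k → InIm w × InKer k × u ≈ (w +V k)))
    × (∀ u → InIm u → InIm (σ u))
    × (∀ u → InKer u → InKer (σ u))
    × (∀ (π : Permutation′ 5) → π ⟨$⟩ʳ # 4 ≡ # 4 →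
         ∀ u → σ (permV π u) ≈ permV π (σ u))
mainTheorem3 =
    (image-hasDim5 , kernel-hasDim5)
  , (image∩kernel≈0 , image⊕kernel)
  , σ-image
  , σ-kernel
  , σ-permV
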